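{- Let $G$ be a maximal triangle-free subgraph of $\mathcal D_n$. Then every vertex of $G$ has at most $4$ neighbours in $G$. Moreover, if a vertex $v$ of $G$ has distinct neighbours $a$ and $b$ in $G$ with $a\neq b^*$, then the neighbours of $v$ in $G$ are exactly the four vertices $a,b,a^*,b^*$.
   Context: Let $e_1,\dots,e_n$ be an orthonormal basis of $\mathbb R^n$. $\mathcal D_n$ is the signed graph with the $n(n-1)$ vertices $e_i\pm e_j$ ($1\le i<j\le n$), distinct vertices $u,v$ being joined by an edge of sign $u\cdot v$ whenever $u\cdot v\ne0$. Subgraphs are induced subgraphs. A triangle is a set of three pairwise adjacent vertices. A maximal triangle-free subgraph of $\mathcal D_n$ is a triangle-free induced subgraph not contained in a strictly larger triangle-free induced subgraph of $\mathcal D_n$. For $v=e_i\pm e_j$ ($i<j$) the conjugate vertex is $v^*=e_i\mp e_j$. -}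

module Defs where

open import Data.Nat using (ℕ; _≤_)
open import Data.Bool using (Bool; true; false; not)
open import Data.Fin using (Fin; _<_; _≟_)
open import Data.Integer using (ℤ; +_; -_; _+_; _*_; 0ℤ; 1ℤ)
open import Data.List using (List; map; foldr; allFin; length)
open import Data.Product using (_×_; Σ; ∃)
open import Data.Empty using (⊥)
open import Relation.Nullary using (¬_; yes; no)
open import Relation.Binary.PropositionalEquality using (_≡_)

-- The vertex e_i + e_j (sign = true) or e_i - e_j (sign = false), with i < j.
record Vertex (n : ℕ) : Set where
  constructor vtx
  field
    i    : Fin n
    j    : Fin n
    i<j  : i < j
    sign : Bool

open Vertex public

coord : ∀ {n} → Vertex n → Fin n → ℤ
coord v k with k ≟ i v | k ≟ j v
... | yes _ | _     = 1ℤ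
... | no _  | yes _ = if-sign (sign v)
  where
  if-sign : Bool → ℤ
  if-sign true  = 1ℤ
  if-sign false = - 1ℤ
... | no _  | no _  = 0ℤ

dot : ∀ {n} → Vertex n → Vertex n → ℤ
dot {n} u v = foldr _+_ 0ℤ (map (λ k → coord u k * coord v k) (allFin n))

Adj : ∀ {n} → Vertex n → Vertex n → Set
Adj u v = (¬ u ≡ v) × (¬ dot u v ≡ 0ℤ)

conj : ∀ {n} → Vertex n → Vertex n
conj (vtx i j p s) = vtx i j p (not s)

-- induced subgraphs of D_n are given by their (decidable) vertex sets
Subgraph : ℕ → Set
Subgraph n = Vertex n → Bool

_∈G_ : ∀ {n} → Vertex n → Subgraph n → Set
v ∈G G = G v ≡ true

_⊆G_ : ∀ {n} → Subgraph n → Subgraph n → Set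
G ⊆G H = ∀ v → v ∈G G → v ∈G H

TriangleFree : ∀ {n} → Subgraph n → Set
TriangleFree G = ∀ x y z → x ∈G G → y ∈G G → z ∈G G →
  Adj x y → Adj y z → Adj x z → ⊥

MaximalTriangleFree : ∀ {n} → Subgraph n → Set
MaximalTriangleFree G = TriangleFree G ×
  (∀ H → G ⊆G H → TriangleFree H → H ⊆G G)

-- Two vertices of D_n are adjacent exactly when their supports {i, j} meet
-- without being equal, and the two vertices with a given support are u and u*.
-- Every neighbour of v = e_i ± e_j therefore contains exactly one of i, j.  In a
-- triangle-free G, two neighbours of v in G sharing an index are not adjacent,
-- so they have the same support and form a pair {x, x*}: each of the two indices
-- carries at most two neighbours, giving degree at most 4.  Maximality makes G
-- closed under conjugation, since u* has the same neighbours as u and is not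
-- adjacent to it.  Since a ≠ b, b* they use different indices of v, so every
-- neighbour of v is one of a, a*, b, b*, and all four are neighbours in G.
module Submission where

open import Defs
open import Data.Nat using (ℕ; _≤_; z≤n; s≤s; _+_)
open import Data.Nat.Properties using (+-suc; +-mono-≤; module ≤-Reasoning)
open import Data.Bool using (true; false; not; _∨_) renaming (_≟_ to _≟ᵇ_)
open import Data.Bool.Properties using (∨-zeroʳ; not-involutive)
open import Data.Fin using (Fin; zero; suc) renaming (_<_ to _<ᶠ_; _≟_ to _≟ᶠ_)
open import Data.Fin.Properties using (suc-injective; <-irrefl; <-trans; <-irrelevant)
open import Data.Integer using (ℤ; 0ℤ; 1ℤ; -_; _*_) renaming (_+_ to _+ℤ_)
open import Data.Integer.Properties using (+-identityˡ; +-identityʳ; +-comm; *-zeroʳ)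
open import Data.List using (List; []; _∷_; length; foldr; tabulate; filter)
open import Data.List.Properties using (map-tabulate)
open import Data.List.Relation.Unary.All as All using (All; []; _∷_)
open import Data.List.Relation.Unary.All.Properties using (all-filter; filter⁺)
open import Data.List.Relation.Unary.AllPairs using (_∷_)
open import Data.List.Relation.Unary.Unique.Propositional using (Unique)
import Data.List.Relation.Unary.Unique.Propositional.Properties as Unique
open import Data.Product using (_×_; _,_; Σ; proj₁)
open import Data.Sum using (_⊎_; inj₁; inj₂; [_,_])
open import Data.Empty using (⊥; ⊥-elim)
open import Function.Bundles using (_⇔_; mk⇔)
open import Relation.Nullary using (¬_; Dec; yes; no; does; contradiction; _×-dec_)
open import Relation.Unary using (Pred; Decidable)
open import Relation.Unary.Properties using (∁?)
open import Relation.Binary.PropositionalEquality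
  using (_≡_; refl; sym; trans; cong; subst; module ≡-Reasoning)

length≡filter+filter : ∀ {a p} {A : Set a} {P : Pred A p} (P? : Decidable P) (xs : List A) →
  length xs ≡ length (filter P? xs) + length (filter (∁? P?) xs)
length≡filter+filter P? [] = refl
length≡filter+filter P? (x ∷ xs) with P? x
... | yes _ = cong ℕ.suc (length≡filter+filter P? xs)
... | no _ = trans (cong ℕ.suc (length≡filter+filter P? xs)) (sym (+-suc _ _))

sumFin : ∀ m → (Fin m → ℤ) → ℤ
sumFin m f = foldr _+ℤ_ 0ℤ (tabulate f)

sumFin-zero : ∀ m (f : Fin m → ℤ) → (∀ k → f k ≡ 0ℤ) → sumFin m f ≡ 0ℤ
sumFin-zero ℕ.zero f f≡0 = refl
sumFin-zero (ℕ.suc m) f f≡0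
  rewrite f≡0 zero | sumFin-zero m (λ k → f (suc k)) (λ k → f≡0 (suc k)) = refl

sumFin-single : ∀ m (f : Fin m → ℤ) a → (∀ k → ¬ k ≡ a → f k ≡ 0ℤ) → sumFin m f ≡ f a
sumFin-single (ℕ.suc m) f zero f≡0
  rewrite sumFin-zero m (λ k → f (suc k)) (λ k → f≡0 (suc k) (λ ())) = +-identityʳ (f zero)
sumFin-single (ℕ.suc m) f (suc a) f≡0
  rewrite f≡0 zero (λ ())
        | sumFin-single m (λ k → f (suc k)) a (λ k k≢a → f≡0 (suc k) (λ e → k≢a (suc-injective e)))
  = +-identityˡ (f (suc a))

sumFin-pair : ∀ m (f : Fin m → ℤ) a b → ¬ a ≡ b →
  (∀ k → ¬ k ≡ a → ¬ k ≡ b → f k ≡ 0ℤ) → sumFin m f ≡ f a +ℤ f b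
sumFin-pair (ℕ.suc m) f zero zero a≢b f≡0 = contradiction refl a≢b
sumFin-pair (ℕ.suc m) f zero (suc b) a≢b f≡0
  rewrite sumFin-single m (λ k → f (suc k)) b
            (λ k k≢b → f≡0 (suc k) (λ ()) (λ e → k≢b (suc-injective e)))
  = refl
sumFin-pair (ℕ.suc m) f (suc a) zero a≢b f≡0
  rewrite sumFin-single m (λ k → f (suc k)) a
            (λ k k≢a → f≡0 (suc k) (λ e → k≢a (suc-injective e)) (λ ()))
  = +-comm (f zero) (f (suc a))
sumFin-pair (ℕ.suc m) f (suc a) (suc b) a≢b f≡0
  rewrite f≡0 zero (λ ()) (λ ())
        | sumFin-pair m (λ k → f (suc k)) a b (λ e → a≢b (cong suc e))
            (λ k k≢a k≢b → f≡0 (suc k) (λ e → k≢a (suc-injective e)) (λ e → k≢b (suc-injective e)))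
  = +-identityˡ _

dot≡sumFin : ∀ {n} (u v : Vertex n) → dot u v ≡ sumFin n (λ k → coord u k * coord v k)
dot≡sumFin u v = cong (foldr _+ℤ_ 0ℤ) (map-tabulate (λ k → k) (λ k → coord u k * coord v k))

_∈supp_ : ∀ {n} → Fin n → Vertex n → Set
k ∈supp u = k ≡ i u ⊎ k ≡ j u

_∈supp?_ : ∀ {n} (k : Fin n) u → Dec (k ∈supp u)
k ∈supp? u with k ≟ᶠ i u | k ≟ᶠ j u
... | yes k≡i | _ = yes (inj₁ k≡i)
... | no _ | yes k≡j = yes (inj₂ k≡j)
... | no k≢i | no k≢j = no [ k≢i , k≢j ]

Meet : ∀ {n} → Vertex n → Vertex n → Set
Meet {n} u v = Σ (Fin n) λ k → k ∈supp u × k ∈supp v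

SameSupport : ∀ {n} → Vertex n → Vertex n → Set
SameSupport u v = (i u ≡ i v) × (j u ≡ j v)

IsUnit : ℤ → Set
IsUnit z = z ≡ 1ℤ ⊎ z ≡ - 1ℤ

unit*unit≢0 : ∀ {a b} → IsUnit a → IsUnit b → ¬ a * b ≡ 0ℤ
unit*unit≢0 (inj₁ refl) (inj₁ refl) ()
unit*unit≢0 (inj₁ refl) (inj₂ refl) ()
unit*unit≢0 (inj₂ refl) (inj₁ refl) ()
unit*unit≢0 (inj₂ refl) (inj₂ refl) ()

coord-∉supp : ∀ {n} (u : Vertex n) k → ¬ k ∈supp u → coord u k ≡ 0ℤ
coord-∉supp u k k∉u with k ≟ᶠ i u | k ≟ᶠ j u
... | yes k≡i | _ = contradiction (inj₁ k≡i) k∉u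
... | no _ | yes k≡j = contradiction (inj₂ k≡j) k∉u
... | no _ | no _ = refl

coord-∈supp : ∀ {n} (u : Vertex n) k → k ∈supp u → IsUnit (coord u k)
coord-∈supp (vtx i j _ s) k k∈u with k ≟ᶠ i | k ≟ᶠ j
... | yes _ | _ = inj₁ refl
... | no k≢i | no k≢j = ⊥-elim ([ k≢i , k≢j ] k∈u)
coord-∈supp (vtx i j _ true) k k∈u | no _ | yes _ = inj₁ refl
coord-∈supp (vtx i j _ false) k k∈u | no _ | yes _ = inj₂ refl

coord*coord-∉supp : ∀ {n} (u v : Vertex n) k → ¬ (k ∈supp u × k ∈supp v) →
  coord u k * coord v k ≡ 0ℤ
coord*coord-∉supp u v k k∉u∩v with k ∈supp? u | k ∈supp? v
... | yes k∈u | yes k∈v = contradiction (k∈u , k∈v) k∉u∩v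
... | no k∉u | _ rewrite coord-∉supp u k k∉u = refl
... | yes _ | no k∉v rewrite coord-∉supp v k k∉v = *-zeroʳ (coord u k)

dot-conj≡0 : ∀ {n} (u : Vertex n) → dot u (conj u) ≡ 0ℤ
dot-conj≡0 {n} u@(vtx a b a<b s) = begin
  dot u (conj u)
    ≡⟨ dot≡sumFin u (conj u) ⟩
  sumFin n (λ k → coord u k * coord (conj u) k)
    ≡⟨ sumFin-pair n _ a b (λ a≡b → <-irrefl a≡b a<b) outside ⟩
  coord u a * coord (conj u) a +ℤ coord u b * coord (conj u) b
    ≡⟨ cancel s ⟩
  0ℤ ∎
  where
  open ≡-Reasoning
  outside : ∀ k → ¬ k ≡ a → ¬ k ≡ b → coord u k * coord (conj u) k ≡ 0ℤ
  outside k k≢a k≢b = coord*coord-∉supp u (conj u) k (λ (k∈u , _) → [ k≢a , k≢b ] k∈u)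
  cancel : ∀ s → coord (vtx a b a<b s) a * coord (vtx a b a<b (not s)) a
               +ℤ coord (vtx a b a<b s) b * coord (vtx a b a<b (not s)) b ≡ 0ℤ
  cancel s with a ≟ᶠ a | b ≟ᶠ a | b ≟ᶠ b
  ... | no a≢a | _ | _ = contradiction refl a≢a
  ... | yes _ | yes b≡a | _ = contradiction (sym b≡a) (λ a≡b → <-irrefl a≡b a<b)
  ... | yes _ | no _ | no b≢b = contradiction refl b≢b
  cancel true | yes _ | no _ | yes _ = refl
  cancel false | yes _ | no _ | yes _ = refl

vertex-≡ : ∀ {n} {u v : Vertex n} → i u ≡ i v → j u ≡ j v → sign u ≡ sign v → u ≡ v
vertex-≡ {u = vtx a b p s} {vtx .a .b q .s} refl refl refl =
  cong (λ r → vtx a b r s) (<-irrelevant p q)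

_≟ᵥ_ : ∀ {n} (u v : Vertex n) → Dec (u ≡ v)
u ≟ᵥ v with i u ≟ᶠ i v | j u ≟ᶠ j v | sign u ≟ᵇ sign v
... | yes i≡ | yes j≡ | yes s≡ = yes (vertex-≡ i≡ j≡ s≡)
... | no i≢ | _ | _ = no λ { refl → i≢ refl }
... | yes _ | no j≢ | _ = no λ { refl → j≢ refl }
... | yes _ | yes _ | no s≢ = no λ { refl → s≢ refl }

conj-involutive : ∀ {n} (u : Vertex n) → conj (conj u) ≡ u
conj-involutive (vtx a b p s) = cong (vtx a b p) (not-involutive s)

sameSupport⇒≡⊎≡conj : ∀ {n} (u v : Vertex n) → SameSupport u v → v ≡ u ⊎ v ≡ conj u
sameSupport⇒≡⊎≡conj (vtx _ _ _ true) (vtx _ _ _ true) (i≡ , j≡) = inj₁ (vertex-≡ (sym i≡) (sym j≡) refl)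
sameSupport⇒≡⊎≡conj (vtx _ _ _ false) (vtx _ _ _ false) (i≡ , j≡) = inj₁ (vertex-≡ (sym i≡) (sym j≡) refl)
sameSupport⇒≡⊎≡conj (vtx _ _ _ true) (vtx _ _ _ false) (i≡ , j≡) = inj₂ (vertex-≡ (sym i≡) (sym j≡) refl)
sameSupport⇒≡⊎≡conj (vtx _ _ _ false) (vtx _ _ _ true) (i≡ , j≡) = inj₂ (vertex-≡ (sym i≡) (sym j≡) refl)

supports-uncrossed : ∀ {n} (u v : Vertex n) → i u ≡ j v → j u ≡ i v → ⊥
supports-uncrossed u v iu≡jv ju≡iv = <-irrefl refl
  (subst (_<ᶠ j v) iu≡jv (<-trans (subst (i u <ᶠ_) ju≡iv (i<j u)) (i<j v)))

twoShared⇒sameSupport : ∀ {n} (u v : Vertex n) {k l} → ¬ k ≡ l →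
  k ∈supp u → l ∈supp u → k ∈supp v → l ∈supp v → SameSupport u v
twoShared⇒sameSupport u v k≢l (inj₁ k≡) (inj₁ l≡) _ _ = contradiction (trans k≡ (sym l≡)) k≢l
twoShared⇒sameSupport u v k≢l (inj₂ k≡) (inj₂ l≡) _ _ = contradiction (trans k≡ (sym l≡)) k≢l
twoShared⇒sameSupport u v k≢l _ _ (inj₁ k≡) (inj₁ l≡) = contradiction (trans k≡ (sym l≡)) k≢l
twoShared⇒sameSupport u v k≢l _ _ (inj₂ k≡) (inj₂ l≡) = contradiction (trans k≡ (sym l≡)) k≢l
twoShared⇒sameSupport u v k≢l (inj₁ k≡) (inj₂ l≡) (inj₁ k≡′) (inj₂ l≡′) =
  trans (sym k≡) k≡′ , trans (sym l≡) l≡′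
twoShared⇒sameSupport u v k≢l (inj₂ k≡) (inj₁ l≡) (inj₂ k≡′) (inj₁ l≡′) =
  trans (sym l≡) l≡′ , trans (sym k≡) k≡′
twoShared⇒sameSupport u v k≢l (inj₁ k≡) (inj₂ l≡) (inj₂ k≡′) (inj₁ l≡′) =
  ⊥-elim (supports-uncrossed u v (trans (sym k≡) k≡′) (trans (sym l≡) l≡′))
twoShared⇒sameSupport u v k≢l (inj₂ k≡) (inj₁ l≡) (inj₁ k≡′) (inj₂ l≡′) =
  ⊥-elim (supports-uncrossed u v (trans (sym l≡) l≡′) (trans (sym k≡) k≡′))

meet×¬sameSupport⇒Adj : ∀ {n} (u v : Vertex n) → Meet u v → ¬ SameSupport u v → Adj u v
meet×¬sameSupport⇒Adj {n} u v (k , k∈u , k∈v) ¬same = u≢v , dot≢0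
  where
  u≢v : ¬ u ≡ v
  u≢v refl = ¬same (refl , refl)
  onlyAt-k : ∀ l → ¬ l ≡ k → coord u l * coord v l ≡ 0ℤ
  onlyAt-k l l≢k = coord*coord-∉supp u v l
    (λ (l∈u , l∈v) → ¬same (twoShared⇒sameSupport u v l≢k l∈u k∈u l∈v k∈v))
  dot≢0 : ¬ dot u v ≡ 0ℤ
  dot≢0 dot≡0 = unit*unit≢0 (coord-∈supp u k k∈u) (coord-∈supp v k k∈v)
    (trans (sym (sumFin-single n _ k onlyAt-k)) (trans (sym (dot≡sumFin u v)) dot≡0))

Adj⇒meet×¬sameSupport : ∀ {n} (u v : Vertex n) → Adj u v → Meet u v × ¬ SameSupport u v
Adj⇒meet×¬sameSupport {n} u v (u≢v , dot≢0) = meet , ¬same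
  where
  meet : Meet u v
  meet with i u ∈supp? v | j u ∈supp? v
  ... | yes iu∈v | _ = i u , inj₁ refl , iu∈v
  ... | no _ | yes ju∈v = j u , inj₂ refl , ju∈v
  ... | no iu∉v | no ju∉v = ⊥-elim (dot≢0 (trans (dot≡sumFin u v) (sumFin-zero n _ nowhere)))
    where
    nowhere : ∀ k → coord u k * coord v k ≡ 0ℤ
    nowhere k = coord*coord-∉supp u v k λ where
      (inj₁ refl , k∈v) → iu∉v k∈v
      (inj₂ refl , k∈v) → ju∉v k∈v
  ¬same : ¬ SameSupport u v
  ¬same same with sameSupport⇒≡⊎≡conj u v same
  ... | inj₁ refl = u≢v refl
  ... | inj₂ refl = dot≢0 (dot-conj≡0 u)

Adj-sym : ∀ {n} {u v : Vertex n} → Adj u v → Adj v u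
Adj-sym {u = u} {v} u~v with Adj⇒meet×¬sameSupport u v u~v
... | (k , k∈u , k∈v) , ¬same = meet×¬sameSupport⇒Adj v u (k , k∈v , k∈u) λ (i≡ , j≡) → ¬same (sym i≡ , sym j≡)

Adj-conjʳ : ∀ {n} {u w : Vertex n} → Adj u w → Adj u (conj w)
Adj-conjʳ {u = u} {w@(vtx _ _ _ _)} u~w with Adj⇒meet×¬sameSupport u w u~w
... | meet , ¬same = meet×¬sameSupport⇒Adj u (conj w) meet ¬same

Adj-conjˡ : ∀ {n} {u w : Vertex n} → Adj (conj u) w → Adj u w
Adj-conjˡ {u = u} u*~w = subst (λ x → Adj x _) (conj-involutive u) (Adj-sym (Adj-conjʳ (Adj-sym u*~w)))

Adj⇒endpoint : ∀ {n} {v w : Vertex n} → Adj v w → i v ∈supp w ⊎ j v ∈supp w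
Adj⇒endpoint {v = v} {w} v~w with proj₁ (Adj⇒meet×¬sameSupport v w v~w)
... | k , inj₁ refl , k∈w = inj₁ k∈w
... | k , inj₂ refl , k∈w = inj₂ k∈w

twoOfThreeNeighbours-meet : ∀ {n} {v x y z : Vertex n} → Adj v x → Adj v y → Adj v z →
  Meet x y ⊎ Meet x z ⊎ Meet y z
twoOfThreeNeighbours-meet {v = v} v~x v~y v~z
  with Adj⇒endpoint v~x | Adj⇒endpoint v~y | Adj⇒endpoint v~z
... | inj₁ x∋ | inj₁ y∋ | _ = inj₁ (i v , x∋ , y∋)
... | inj₂ x∋ | inj₂ y∋ | _ = inj₁ (j v , x∋ , y∋)
... | inj₁ x∋ | inj₂ _ | inj₁ z∋ = inj₂ (inj₁ (i v , x∋ , z∋))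
... | inj₂ x∋ | inj₁ _ | inj₂ z∋ = inj₂ (inj₁ (j v , x∋ , z∋))
... | inj₁ _ | inj₂ y∋ | inj₂ z∋ = inj₂ (inj₂ (j v , y∋ , z∋))
... | inj₂ _ | inj₁ y∋ | inj₁ z∋ = inj₂ (inj₂ (i v , y∋ , z∋))

module TriangleFreeNeighbourhood {n : ℕ} (G : Subgraph n) (triangleFree : TriangleFree G) where

  NeighbourIn : Vertex n → Vertex n → Set
  NeighbourIn v w = w ∈G G × Adj v w

  meetingNeighbours-conjugate : ∀ {v x y} → v ∈G G → NeighbourIn v x → NeighbourIn v y → Meet x y →
    y ≡ x ⊎ y ≡ conj x
  meetingNeighbours-conjugate {v} {x} {y} vG (xG , v~x) (yG , v~y) meet
    with (i x ≟ᶠ i y) ×-dec (j x ≟ᶠ j y)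
  ... | yes same = sameSupport⇒≡⊎≡conj x y same
  ... | no ¬same = ⊥-elim (triangleFree v x y vG xG yG v~x (meet×¬sameSupport⇒Adj x y meet ¬same) v~y)

  throughIndex-length≤2 : ∀ {v} k → v ∈G G → ∀ xs → Unique xs →
    All (λ w → NeighbourIn v w × k ∈supp w) xs → length xs ≤ 2
  throughIndex-length≤2 k vG [] _ _ = z≤n
  throughIndex-length≤2 k vG (_ ∷ []) _ _ = s≤s z≤n
  throughIndex-length≤2 k vG (_ ∷ _ ∷ []) _ _ = s≤s (s≤s z≤n)
  throughIndex-length≤2 k vG (x ∷ y ∷ z ∷ _) ((x≢y ∷ x≢z ∷ _) ∷ (y≢z ∷ _) ∷ _)
    ((x∼ , k∈x) ∷ (y∼ , k∈y) ∷ (z∼ , k∈z) ∷ _)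
    with meetingNeighbours-conjugate vG x∼ y∼ (k , k∈x , k∈y)
       | meetingNeighbours-conjugate vG x∼ z∼ (k , k∈x , k∈z)
  ... | inj₁ y≡x | _ = contradiction (sym y≡x) x≢y
  ... | inj₂ _ | inj₁ z≡x = contradiction (sym z≡x) x≢z
  ... | inj₂ y≡x* | inj₂ z≡x* = contradiction (trans y≡x* (sym z≡x*)) y≢z

  degree≤4 : ∀ v → v ∈G G → ∀ xs → Unique xs → All (NeighbourIn v) xs → length xs ≤ 4
  degree≤4 v vG xs unique neighbours = begin
    length xs
      ≡⟨ length≡filter+filter through-i? xs ⟩
    length (filter through-i? xs) + length (filter (∁? through-i?) xs)
      ≤⟨ +-mono-≤ bound-i bound-j ⟩
    4 ∎
    where
    open ≤-Reasoning
    through-i? : Decidable (λ w → i v ∈supp w)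
    through-i? w = i v ∈supp? w
    bound-i : length (filter through-i? xs) ≤ 2
    bound-i = throughIndex-length≤2 (i v) vG _ (Unique.filter⁺ through-i? unique)
      (All.zip (filter⁺ through-i? neighbours , all-filter through-i? xs))
    through-j : ∀ {w} → NeighbourIn v w × ¬ i v ∈supp w → NeighbourIn v w × j v ∈supp w
    through-j ((wG , v~w) , iv∉w) with Adj⇒endpoint v~w
    ... | inj₁ iv∈w = contradiction iv∈w iv∉w
    ... | inj₂ jv∈w = (wG , v~w) , jv∈w
    bound-j : length (filter (∁? through-i?) xs) ≤ 2
    bound-j = throughIndex-length≤2 (j v) vG _ (Unique.filter⁺ (∁? through-i?) unique)
      (All.zipWith through-j (filter⁺ (∁? through-i?) neighbours , all-filter (∁? through-i?) xs))

  neighbours⊆conjugatePairs : ∀ {v a b w} → v ∈G G → NeighbourIn v a → NeighbourIn v b →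
    ¬ a ≡ b → ¬ a ≡ conj b → NeighbourIn v w → w ≡ a ⊎ w ≡ b ⊎ w ≡ conj a ⊎ w ≡ conj b
  neighbours⊆conjugatePairs {a = a} vG a∼@(_ , v~a) b∼@(_ , v~b) a≢b a≢b* w∼@(_ , v~w)
    with twoOfThreeNeighbours-meet v~a v~b v~w
  ... | inj₁ a⋈b with meetingNeighbours-conjugate vG a∼ b∼ a⋈b
  ...   | inj₁ b≡a = contradiction (sym b≡a) a≢b
  ...   | inj₂ b≡a* = contradiction (trans (sym (conj-involutive a)) (cong conj (sym b≡a*))) a≢b*
  neighbours⊆conjugatePairs vG a∼ b∼ _ _ w∼ | inj₂ (inj₁ a⋈w)
    with meetingNeighbours-conjugate vG a∼ w∼ a⋈w
  ...   | inj₁ w≡a = inj₁ w≡a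
  ...   | inj₂ w≡a* = inj₂ (inj₂ (inj₁ w≡a*))
  neighbours⊆conjugatePairs vG a∼ b∼ _ _ w∼ | inj₂ (inj₂ b⋈w)
    with meetingNeighbours-conjugate vG b∼ w∼ b⋈w
  ...   | inj₁ w≡b = inj₂ (inj₁ w≡b)
  ...   | inj₂ w≡b* = inj₂ (inj₂ (inj₂ w≡b*))

insert : ∀ {n} → Vertex n → Subgraph n → Subgraph n
insert c G x = G x ∨ does (x ≟ᵥ c)

∈insert⁻ : ∀ {n} (c : Vertex n) G x → x ∈G insert c G → x ∈G G ⊎ x ≡ c
∈insert⁻ c G x x∈ with G x | x ≟ᵥ c
... | true | _ = inj₁ refl
... | false | yes x≡c = inj₂ x≡c
... | false | no _ with () ← x∈

⊆insert : ∀ {n} (c : Vertex n) G → G ⊆G insert c G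
⊆insert c G x x∈G rewrite x∈G = refl

c∈insert : ∀ {n} (c : Vertex n) G → c ∈G insert c G
c∈insert c G with c ≟ᵥ c
... | yes _ = ∨-zeroʳ (G c)
... | no c≢c = contradiction refl c≢c

-- A triangle through c would turn into one through a; it cannot use c twice since Adj is irreflexive.
insert-triangleFree : ∀ {n} {G : Subgraph n} {a c} → TriangleFree G → a ∈G G →
  (∀ {y} → Adj c y → Adj a y) → TriangleFree (insert c G)
insert-triangleFree {G = G} {a} {c} triangleFree aG c∼⇒a∼ x y z x∈ y∈ z∈ x~y y~z x~z
  with ∈insert⁻ c G x x∈ | ∈insert⁻ c G y y∈ | ∈insert⁻ c G z z∈
... | inj₁ xG | inj₁ yG | inj₁ zG = triangleFree x y z xG yG zG x~y y~z x~z
... | inj₂ refl | inj₁ yG | inj₁ zG = triangleFree a y z aG yG zG (c∼⇒a∼ x~y) y~z (c∼⇒a∼ x~z)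
... | inj₁ xG | inj₂ refl | inj₁ zG = triangleFree a x z aG xG zG (c∼⇒a∼ (Adj-sym x~y)) x~z (c∼⇒a∼ y~z)
... | inj₁ xG | inj₁ yG | inj₂ refl = triangleFree a x y aG xG yG (c∼⇒a∼ (Adj-sym x~z)) x~y (c∼⇒a∼ (Adj-sym y~z))
... | inj₂ refl | inj₂ refl | _ = proj₁ x~y refl
... | inj₂ refl | inj₁ _ | inj₂ refl = proj₁ x~z refl
... | inj₁ _ | inj₂ refl | inj₂ refl = proj₁ y~z refl

maximalTriangleFree-conj : ∀ {n} {G : Subgraph n} → MaximalTriangleFree G → ∀ {a} → a ∈G G → conj a ∈G G
maximalTriangleFree-conj {G = G} (triangleFree , maximal) {a} aG =
  maximal (insert (conj a) G) (⊆insert (conj a) G)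
    (insert-triangleFree triangleFree aG Adj-conjˡ) (conj a) (c∈insert (conj a) G)

neighbourhood⇔conjugatePairs : ∀ {n} {G : Subgraph n} → MaximalTriangleFree G →
  ∀ {v a b} → v ∈G G → a ∈G G → b ∈G G → Adj v a → Adj v b → ¬ a ≡ b → ¬ a ≡ conj b →
  ∀ w → (w ∈G G × Adj v w) ⇔ (w ≡ a ⊎ w ≡ b ⊎ w ≡ conj a ⊎ w ≡ conj b)
neighbourhood⇔conjugatePairs {G = G} maximal {v} {a} {b} vG aG bG v~a v~b a≢b a≢b* w =
  mk⇔ (neighbours⊆conjugatePairs vG (aG , v~a) (bG , v~b) a≢b a≢b*) conjugatePairs⊆neighbours
  where
  open TriangleFreeNeighbourhood G (proj₁ maximal)
  conjugatePairs⊆neighbours : w ≡ a ⊎ w ≡ b ⊎ w ≡ conj a ⊎ w ≡ conj b → w ∈G G × Adj v w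
  conjugatePairs⊆neighbours (inj₁ refl) = aG , v~a
  conjugatePairs⊆neighbours (inj₂ (inj₁ refl)) = bG , v~b
  conjugatePairs⊆neighbours (inj₂ (inj₂ (inj₁ refl))) = maximalTriangleFree-conj maximal aG , Adj-conjʳ v~a
  conjugatePairs⊆neighbours (inj₂ (inj₂ (inj₂ refl))) = maximalTriangleFree-conj maximal bG , Adj-conjʳ v~b

lemma7p9 : ∀ (n : ℕ) (G : Subgraph n) → MaximalTriangleFree G →
    (∀ (v : Vertex n) → v ∈G G →
      ∀ (xs : List (Vertex n)) → Unique xs →
        All (λ w → w ∈G G × Adj v w) xs → length xs ≤ 4)
    × (∀ (v a b : Vertex n) → v ∈G G → a ∈G G → b ∈G G →
        Adj v a → Adj v b → ¬ a ≡ b → ¬ a ≡ conj b →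
        ∀ (w : Vertex n) →
          ((w ∈G G × Adj v w) ⇔ (w ≡ a ⊎ w ≡ b ⊎ w ≡ conj a ⊎ w ≡ conj b)))
lemma7p9 n G maximal =
  TriangleFreeNeighbourhood.degree≤4 G (proj₁ maximal) ,
  λ v a b → neighbourhood⇔conjugatePairs maximal
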